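{- For each integer $r$ and each non-negative integer $n$, \[ \sum_{k = 0}^n \binom {2k}{k} \binom {2(n - k)}{n-k} F_{4k+r} = F_{2n+r} \sum_{k = 0}^n \binom {n}{k}^2 5^k, \qquad \sum_{k = 0}^n \binom {2k}{k} \binom {2(n - k)}{n-k} L_{4k+r} = L_{2n+r} \sum_{k = 0}^n \binom {n}{k}^2 5^k. \]
   Context: $F_j$ and $L_j$ denote the Fibonacci and Lucas numbers: $F_0=0,F_1=1$, $L_0=2,L_1=1$, both satisfying $X_j=X_{j-1}+X_{j-2}$, extended to all integer indices via the recurrence (so $F_{ -j}=(-1)^{j+1}F_j$, $L_{ -j}=(-1)^jL_j$). -}

module Defs where

open import Data.Nat as ℕ using (ℕ; zero; suc)
open import Data.Nat.Combinatorics using (_C_)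
open import Data.Integer as ℤ using (ℤ; +_; -[1+_]; -_)

fibℕ : ℕ → ℕ
fibℕ zero = 0
fibℕ (suc zero) = 1
fibℕ (suc (suc n)) = fibℕ (suc n) ℕ.+ fibℕ n

lucℕ : ℕ → ℕ
lucℕ zero = 2
lucℕ (suc zero) = 1
lucℕ (suc (suc n)) = lucℕ (suc n) ℕ.+ lucℕ n

sgn : ℕ → ℤ
sgn zero = + 1
sgn (suc n) = - sgn n

-- Extension to all integer indices (the unique extension satisfying
-- the recurrence):  F_{-j} = (-1)^{j+1} F_j,  L_{-j} = (-1)^j L_j.
-- For j = n+1:  F_{-(n+1)} = (-1)^n F_{n+1},  L_{-(n+1)} = (-1)^{n+1} L_{n+1}.
F : ℤ → ℤ
F (+ n) = + fibℕ n
F -[1+ n ] = sgn n ℤ.* + fibℕ (suc n)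

L : ℤ → ℤ
L (+ n) = + lucℕ n
L -[1+ n ] = sgn (suc n) ℤ.* + lucℕ (suc n)

sumTo : ℕ → (ℕ → ℤ) → ℤ
sumTo zero f = f 0
sumTo (suc n) f = sumTo n f ℤ.+ f (suc n)

{-# OPTIONS --safe #-}
module Submission where

-- Write A_n(x) = Σ_k C(2k,k) C(2n-2k,n-k) x^k and T_n(x) = Σ_k C(n,k)² x^k. Termwise identities
-- between binomial coefficients give
--   (n+1) A_{n+1}(x) = 2(2n+1)(1+x) A_n(x) - 16 n x A_{n-1}(x),
--   (n+1) T_{n+1}(x) = (2n+1)(1+x) T_n(x) - n (1-x)² T_{n-1}(x).
-- Let G satisfy G(m+2) = G(m+1) + G(m), so that G(m) + G(m+4) = 3 G(m+2). Evaluating A_n at the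
-- shift x^k ↦ G(4k + r), both Σ_k C(2k,k) C(2n-2k,n-k) G(4k+r) and G(2n+r) T_n(5) satisfy the same
-- recurrence in n (with r ↦ r + 4 in the terms carrying x), and they agree at n = 0.

open import Defs
open import Data.Nat as ℕ using (ℕ; zero; suc; _<_; _≤_; s≤s)
open import Data.Nat.Combinatorics using (_C_; nCk+nC[k+1]≡[n+1]C[k+1]; k>n⇒nCk≡0; nC1≡n; nCk≡nC[n∸k])
import Data.Nat.Properties as ℕP
import Data.Nat.Tactic.RingSolver as ℕSolver
open import Data.Integer as ℤ using (ℤ; +_; -[1+_]; -_; _+_; _-_; _*_; _^_)
import Data.Integer.Properties as ℤP
open import Data.Integer.Tactic.RingSolver using (solve; solve-∀)
open import Algebra.Properties.CommutativeSemigroup ℤP.*-commutativeSemigroup using (x∙yz≈y∙xz)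
open import Data.List.Base using (_∷_; [])
open import Data.Product using (_×_; _,_; proj₁)
open import Function.Base using (_∘_)
open import Relation.Binary.PropositionalEquality
open import Relation.Binary.Definitions using (tri<; tri≈; tri>)
open ≡-Reasoning

[k+1]*[n+1]C[k+1]≡[n+1]*nCk : ∀ n k → suc k ℕ.* (suc n C suc k) ≡ suc n ℕ.* (n C k)
[k+1]*[n+1]C[k+1]≡[n+1]*nCk n zero = begin
  1 ℕ.* (suc n C 1) ≡⟨ ℕP.*-identityˡ _ ⟩
  suc n C 1         ≡⟨ nC1≡n (suc n) ⟩
  suc n             ≡⟨ ℕP.*-identityʳ (suc n) ⟨
  suc n ℕ.* 1       ∎
[k+1]*[n+1]C[k+1]≡[n+1]*nCk zero (suc k) = ℕP.*-zeroʳ (suc (suc k))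
[k+1]*[n+1]C[k+1]≡[n+1]*nCk (suc n) (suc k) = begin
  suc (suc k) ℕ.* (suc (suc n) C suc (suc k))
    ≡⟨ cong (suc (suc k) ℕ.*_) (nCk+nC[k+1]≡[n+1]C[k+1] (suc n) (suc k)) ⟨
  suc (suc k) ℕ.* (x ℕ.+ y)
    ≡⟨ regroup k x y ⟩
  x ℕ.+ (suc k ℕ.* x ℕ.+ suc (suc k) ℕ.* y)
    ≡⟨ cong₂ (λ u v → x ℕ.+ (u ℕ.+ v))
         ([k+1]*[n+1]C[k+1]≡[n+1]*nCk n k) ([k+1]*[n+1]C[k+1]≡[n+1]*nCk n (suc k)) ⟩
  x ℕ.+ (suc n ℕ.* (n C k) ℕ.+ suc n ℕ.* (n C suc k))
    ≡⟨ cong (x ℕ.+_) (ℕP.*-distribˡ-+ (suc n) (n C k) (n C suc k)) ⟨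
  x ℕ.+ suc n ℕ.* (n C k ℕ.+ n C suc k)
    ≡⟨ cong (λ z → x ℕ.+ suc n ℕ.* z) (nCk+nC[k+1]≡[n+1]C[k+1] n k) ⟩
  suc (suc n) ℕ.* x ∎
  where
  x = suc n C suc k
  y = suc n C suc (suc k)
  regroup : ∀ k x y → suc (suc k) ℕ.* (x ℕ.+ y) ≡ x ℕ.+ (suc k ℕ.* x ℕ.+ suc (suc k) ℕ.* y)
  regroup = ℕSolver.solve-∀

binomial : ℕ → ℕ → ℤ
binomial n k = + (n C k)

binomial-pascal : ∀ n k → binomial (suc n) (suc k) ≡ binomial n k + binomial n (suc k)
binomial-pascal n k = trans (cong +_ (sym (nCk+nC[k+1]≡[n+1]C[k+1] n k))) (ℤP.pos-+ (n C k) (n C suc k))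

binomial-absorb : ∀ n k → + suc k * binomial (suc n) (suc k) ≡ + suc n * binomial n k
binomial-absorb n k = begin
  + suc k * binomial (suc n) (suc k)    ≡⟨ ℤP.pos-* (suc k) (suc n C suc k) ⟨
  + (suc k ℕ.* (suc n C suc k))         ≡⟨ cong +_ ([k+1]*[n+1]C[k+1]≡[n+1]*nCk n k) ⟩
  + (suc n ℕ.* (n C k))                 ≡⟨ ℤP.pos-* (suc n) (n C k) ⟩
  + suc n * binomial n k                ∎

binomial-beyond : ∀ {n k} → n < k → binomial n k ≡ + 0
binomial-beyond n<k = cong +_ (k>n⇒nCk≡0 n<k)

binomial-1 : ∀ n → binomial n 1 ≡ + n
binomial-1 n = cong +_ (nC1≡n n)

binomial-ratio : ∀ n k → + suc k * binomial n (suc k) ≡ (+ n - + k) * binomial n k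
binomial-ratio n k = isolate (+ n) (+ k) (binomial n k) (binomial n (suc k))
  (trans (cong (+ suc k *_) (sym (binomial-pascal n k))) (binomial-absorb n k))
  where
  isolate : ∀ x y a b → (+ 1 + y) * (a + b) ≡ (+ 1 + x) * a → (+ 1 + y) * b ≡ (x - y) * a
  isolate x y a b e = begin
    (+ 1 + y) * b                       ≡⟨ solve (y ∷ a ∷ b ∷ []) ⟩
    (+ 1 + y) * (a + b) - (+ 1 + y) * a ≡⟨ cong (_- (+ 1 + y) * a) e ⟩
    (+ 1 + x) * a - (+ 1 + y) * a       ≡⟨ solve (x ∷ y ∷ a ∷ []) ⟩
    (x - y) * a                         ∎

pos-^ : ∀ m k → + (m ℕ.^ k) ≡ (+ m) ^ k
pos-^ m zero    = refl
pos-^ m (suc k) = trans (ℤP.pos-* m (m ℕ.^ k)) (cong (+ m *_) (pos-^ m k))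

centralBinomial : ℕ → ℤ
centralBinomial k = binomial (2 ℕ.* k) k

centralBinomial-rec : ∀ k → + suc k * centralBinomial (suc k) ≡ + 2 * (+ 2 * + k + + 1) * centralBinomial k
centralBinomial-rec k = ℤP.*-cancelˡ-≡ (+ suc k) _ _ (begin
  + suc k * (+ suc k * centralBinomial (suc k))
    ≡⟨ cong (λ n → + suc k * (+ suc k * binomial n (suc k))) (2[1+k]≡2+2k k) ⟩
  + suc k * (+ suc k * binomial (suc (suc m)) (suc k))
    ≡⟨ cong (+ suc k *_) (binomial-absorb (suc m) k) ⟩
  + suc k * (+ suc (suc m) * binomial (suc m) k)
    ≡⟨ cong (λ b → + suc k * (+ suc (suc m) * b)) middle-symmetric ⟩
  + suc k * (+ suc (suc m) * binomial (suc m) (suc k))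
    ≡⟨ x∙yz≈y∙xz (+ suc k) (+ suc (suc m)) (binomial (suc m) (suc k)) ⟩
  + suc (suc m) * (+ suc k * binomial (suc m) (suc k))
    ≡⟨ cong (+ suc (suc m) *_) (binomial-absorb m k) ⟩
  + suc (suc m) * (+ suc m * binomial m k)
    ≡⟨ cong (λ z → (+ 2 + z) * ((+ 1 + z) * binomial m k)) (ℤP.pos-* 2 k) ⟩
  (+ 2 + + 2 * + k) * ((+ 1 + + 2 * + k) * binomial m k)
    ≡⟨ regroup (+ k) (binomial m k) ⟩
  + suc k * (+ 2 * (+ 2 * + k + + 1) * centralBinomial k) ∎)
  where
  m = 2 ℕ.* k
  2[1+k]≡2+2k : ∀ k → 2 ℕ.* suc k ≡ suc (suc (2 ℕ.* k))
  2[1+k]≡2+2k = ℕSolver.solve-∀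
  1+2k≡[1+k]+k : ∀ k → suc (2 ℕ.* k) ≡ suc k ℕ.+ k
  1+2k≡[1+k]+k = ℕSolver.solve-∀
  middle-symmetric : binomial (suc m) k ≡ binomial (suc m) (suc k)
  middle-symmetric = cong +_ (begin
    suc m C k
      ≡⟨ nCk≡nC[n∸k] (subst (k ≤_) (sym (1+2k≡[1+k]+k k)) (ℕP.m≤n+m k (suc k))) ⟩
    suc m C (suc m ℕ.∸ k)
      ≡⟨ cong (λ n → suc m C (n ℕ.∸ k)) (1+2k≡[1+k]+k k) ⟩
    suc m C (suc k ℕ.+ k ℕ.∸ k)
      ≡⟨ cong (suc m C_) (ℕP.m+n∸n≡m (suc k) k) ⟩
    suc m C suc k ∎)
  regroup : ∀ x b → (+ 2 + + 2 * x) * ((+ 1 + + 2 * x) * b) ≡ (+ 1 + x) * (+ 2 * (+ 2 * x + + 1) * b)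
  regroup = solve-∀

sumTo-cong : ∀ n {f g : ℕ → ℤ} → (∀ k → f k ≡ g k) → sumTo n f ≡ sumTo n g
sumTo-cong zero    f≗g = f≗g 0
sumTo-cong (suc n) f≗g = cong₂ _+_ (sumTo-cong n f≗g) (f≗g (suc n))

sumTo-cong-≤ : ∀ n {f g : ℕ → ℤ} → (∀ k → k ≤ n → f k ≡ g k) → sumTo n f ≡ sumTo n g
sumTo-cong-≤ zero    f≗g = f≗g 0 ℕ.z≤n
sumTo-cong-≤ (suc n) f≗g =
  cong₂ _+_ (sumTo-cong-≤ n (λ k k≤n → f≗g k (ℕP.m≤n⇒m≤1+n k≤n))) (f≗g (suc n) ℕP.≤-refl)

sumTo-*ˡ : ∀ n c (f : ℕ → ℤ) → sumTo n (λ k → c * f k) ≡ c * sumTo n f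
sumTo-*ˡ zero    c f = refl
sumTo-*ˡ (suc n) c f =
  trans (cong (_+ c * f (suc n)) (sumTo-*ˡ n c f)) (sym (ℤP.*-distribˡ-+ c (sumTo n f) (f (suc n))))

sumTo-- : ∀ n (f g : ℕ → ℤ) → sumTo n (λ k → f k - g k) ≡ sumTo n f - sumTo n g
sumTo-- zero    f g = refl
sumTo-- (suc n) f g =
  trans (cong (_+ (f (suc n) - g (suc n))) (sumTo-- n f g))
        (interchange (sumTo n f) (sumTo n g) (f (suc n)) (g (suc n)))
  where
  interchange : ∀ a b c d → a - b + (c - d) ≡ a + c - (b + d)
  interchange = solve-∀

sumTo-suc-vanishing : ∀ n (f : ℕ → ℤ) → f (suc n) ≡ + 0 → sumTo (suc n) f ≡ sumTo n f
sumTo-suc-vanishing n f fₙ₊₁≡0 = trans (cong (λ z → sumTo n f + z) fₙ₊₁≡0) (ℤP.+-identityʳ (sumTo n f))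

delay : (ℕ → ℤ) → ℕ → ℤ
delay f zero    = + 0
delay f (suc k) = f k

_⊙_ : (ℕ → ℤ) → (ℕ → ℤ) → ℕ → ℤ
(f ⊙ w) k = f k * w k

sumTo-delay : ∀ n (f : ℕ → ℤ) → sumTo (suc n) (delay f) ≡ sumTo n f
sumTo-delay zero    f = ℤP.+-identityˡ (f 0)
sumTo-delay (suc n) f = cong (_+ f (suc n)) (sumTo-delay n f)

sumTo-delay-⊙ : ∀ n (f w : ℕ → ℤ) → sumTo (suc n) (delay f ⊙ w) ≡ sumTo n (f ⊙ (w ∘ suc))
sumTo-delay-⊙ n f w = trans (sumTo-cong (suc n) delay-⊙) (sumTo-delay n (f ⊙ (w ∘ suc)))
  where
  delay-⊙ : ∀ k → (delay f ⊙ w) k ≡ delay (f ⊙ (w ∘ suc)) k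
  delay-⊙ zero    = refl
  delay-⊙ (suc k) = refl

sumTo-delay-pow : ∀ n (f : ℕ → ℤ) x → sumTo (suc n) (delay f ⊙ (x ^_)) ≡ x * sumTo n (f ⊙ (x ^_))
sumTo-delay-pow n f x = begin
  sumTo (suc n) (delay f ⊙ (x ^_))   ≡⟨ sumTo-delay-⊙ n f (x ^_) ⟩
  sumTo n (λ k → f k * (x * x ^ k)) ≡⟨ sumTo-cong n (λ k → x∙yz≈y∙xz (f k) x (x ^ k)) ⟩
  sumTo n (λ k → x * (f k * x ^ k)) ≡⟨ sumTo-*ˡ n x (f ⊙ (x ^_)) ⟩
  x * sumTo n (f ⊙ (x ^_))           ∎

difference : (ℕ → ℤ) → ℕ → ℤ
difference f k = f k - delay f k

sumTo-difference-pow : ∀ n (f : ℕ → ℤ) x → f (suc n) ≡ + 0 →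
  sumTo (suc n) (difference f ⊙ (x ^_)) ≡ (+ 1 - x) * sumTo n (f ⊙ (x ^_))
sumTo-difference-pow n f x fₙ₊₁≡0 = begin
  sumTo (suc n) (difference f ⊙ (x ^_))
    ≡⟨ sumTo-cong (suc n) (λ k → distrib (f k) (delay f k) (x ^ k)) ⟩
  sumTo (suc n) (λ k → (f ⊙ (x ^_)) k - (delay f ⊙ (x ^_)) k)
    ≡⟨ sumTo-- (suc n) (f ⊙ (x ^_)) (delay f ⊙ (x ^_)) ⟩
  sumTo (suc n) (f ⊙ (x ^_)) - sumTo (suc n) (delay f ⊙ (x ^_))
    ≡⟨ cong₂ _-_ (sumTo-suc-vanishing n (f ⊙ (x ^_)) (cong (_* x ^ suc n) fₙ₊₁≡0)) (sumTo-delay-pow n f x) ⟩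
  sumTo n (f ⊙ (x ^_)) - x * sumTo n (f ⊙ (x ^_))
    ≡⟨ factor x (sumTo n (f ⊙ (x ^_))) ⟩
  (+ 1 - x) * sumTo n (f ⊙ (x ^_)) ∎
  where
  distrib : ∀ a b c → (a - b) * c ≡ a * c - b * c
  distrib = solve-∀
  factor : ∀ x S → S - x * S ≡ (+ 1 - x) * S
  factor = solve-∀

sumTo-⊙-rec : ∀ N s α β (c′ c₁ c₂ c₃ w : ℕ → ℤ) → (∀ k → s * c′ k ≡ α * (c₁ k + c₂ k) + β * c₃ k) →
  s * sumTo N (c′ ⊙ w) ≡ α * (sumTo N (c₁ ⊙ w) + sumTo N (c₂ ⊙ w)) + β * sumTo N (c₃ ⊙ w)
sumTo-⊙-rec N s α β c′ c₁ c₂ c₃ w rec = go N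
  where
  weighted : ∀ k → s * (c′ ⊙ w) k ≡ α * ((c₁ ⊙ w) k + (c₂ ⊙ w) k) + β * (c₃ ⊙ w) k
  weighted k = begin
    s * (c′ k * w k)                     ≡⟨ ℤP.*-assoc s (c′ k) (w k) ⟨
    s * c′ k * w k                       ≡⟨ cong (_* w k) (rec k) ⟩
    (α * (c₁ k + c₂ k) + β * c₃ k) * w k ≡⟨ distribute α β (c₁ k) (c₂ k) (c₃ k) (w k) ⟩
    α * (c₁ k * w k + c₂ k * w k) + β * (c₃ k * w k) ∎
    where
    distribute : ∀ α β x y z w → (α * (x + y) + β * z) * w ≡ α * (x * w + y * w) + β * (z * w)
    distribute = solve-∀
  go : ∀ N → s * sumTo N (c′ ⊙ w) ≡ α * (sumTo N (c₁ ⊙ w) + sumTo N (c₂ ⊙ w)) + β * sumTo N (c₃ ⊙ w)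
  go zero    = weighted 0
  go (suc N) = begin
    s * (sumTo N (c′ ⊙ w) + (c′ ⊙ w) (suc N))
      ≡⟨ ℤP.*-distribˡ-+ s (sumTo N (c′ ⊙ w)) ((c′ ⊙ w) (suc N)) ⟩
    s * sumTo N (c′ ⊙ w) + s * (c′ ⊙ w) (suc N)
      ≡⟨ cong₂ _+_ (go N) (weighted (suc N)) ⟩
    α * (sumTo N (c₁ ⊙ w) + sumTo N (c₂ ⊙ w)) + β * sumTo N (c₃ ⊙ w)
      + (α * ((c₁ ⊙ w) (suc N) + (c₂ ⊙ w) (suc N)) + β * (c₃ ⊙ w) (suc N))
      ≡⟨ regroup α β (sumTo N (c₁ ⊙ w)) (sumTo N (c₂ ⊙ w)) (sumTo N (c₃ ⊙ w)) _ _ _ ⟩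
    α * (sumTo (suc N) (c₁ ⊙ w) + sumTo (suc N) (c₂ ⊙ w)) + β * sumTo (suc N) (c₃ ⊙ w) ∎
    where
    regroup : ∀ α β X Y Z x y z →
      α * (X + Y) + β * Z + (α * (x + y) + β * z) ≡ α * (X + x + (Y + y)) + β * (Z + z)
    regroup = solve-∀

-- The convolution of central binomial coefficients

mirror : (ℕ → ℤ) → ℕ → ℕ → ℤ
mirror s n       zero    = s n
mirror s zero    (suc k) = + 0
mirror s (suc n) (suc k) = mirror s n k

mirror-≤ : ∀ s {n k} → k ≤ n → mirror s n k ≡ s (n ℕ.∸ k)
mirror-≤ s {n}     {zero}  _         = refl
mirror-≤ s {suc n} {suc k} (s≤s k≤n) = mirror-≤ s k≤n

mirror-beyond : ∀ s {n k} → n < k → mirror s n k ≡ + 0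
mirror-beyond s {zero}  {suc k} _         = refl
mirror-beyond s {suc n} {suc k} (s≤s n<k) = mirror-beyond s n<k

mirror-+ : ∀ s j t → mirror s (j ℕ.+ t) j ≡ s t
mirror-+ s j t = trans (mirror-≤ s (ℕP.m≤m+n j t)) (cong s (ℕP.m+n∸m≡n j t))

centralConvolution : ℕ → ℕ → ℤ
centralConvolution n k = centralBinomial k * mirror centralBinomial n k

centralConvolution-beyond : ∀ {n k} → n < k → centralConvolution n k ≡ + 0
centralConvolution-beyond {k = k} n<k =
  trans (cong (centralBinomial k *_) (mirror-beyond centralBinomial n<k)) (ℤP.*-zeroʳ (centralBinomial k))

ConvolutionStep : ℕ → (L X Y Z : ℤ) → Set
ConvolutionStep n L X Y Z = + suc n * L ≡ + 2 * (+ 2 * + n + + 1) * (X + Y) + - (+ 16 * + n) * Z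

convolutionStep-cong : ∀ n {L L′ X X′ Y Y′ Z Z′} →
  L ≡ L′ → X ≡ X′ → Y ≡ Y′ → Z ≡ Z′ → ConvolutionStep n L′ X′ Y′ Z′ → ConvolutionStep n L X Y Z
convolutionStep-cong n refl refl refl refl step = step

convolutionStep-boundary : ∀ n X Y → X + Y ≡ centralBinomial n →
  ConvolutionStep n (centralBinomial (suc n)) X Y (+ 0)
convolutionStep-boundary n X Y X+Y≡c =
  trans (centralBinomial-rec n) (pad (+ 2 * (+ 2 * + n + + 1)) (- (+ 16 * + n)) X+Y≡c)
  where
  pad : ∀ α β {c d} → d ≡ c → α * c ≡ α * d + β * + 0
  pad α β {d = d} refl = solve (α ∷ β ∷ d ∷ [])

convolutionStep-product : ∀ j t →
  ConvolutionStep (suc (j ℕ.+ t))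
    (centralBinomial (suc j) * centralBinomial (suc t)) (centralBinomial (suc j) * centralBinomial t)
    (centralBinomial j * centralBinomial (suc t)) (centralBinomial j * centralBinomial t)
convolutionStep-product j t =
  ℤP.*-cancelˡ-≡ (+ suc j * + suc t) _ _ (scaled (+ j) (+ t) (centralBinomial-rec j) (centralBinomial-rec t))
  where
  scaled : ∀ x y {A A′ B B′} →
    (+ 1 + x) * A′ ≡ + 2 * (+ 2 * x + + 1) * A → (+ 1 + y) * B′ ≡ + 2 * (+ 2 * y + + 1) * B →
    (+ 1 + x) * (+ 1 + y) * ((+ 2 + (x + y)) * (A′ * B′)) ≡
    (+ 1 + x) * (+ 1 + y) * (+ 2 * (+ 2 * (+ 1 + (x + y)) + + 1) * (A′ * B + A * B′)
                               + - (+ 16 * (+ 1 + (x + y))) * (A * B))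
  scaled x y {A} {A′} {B} {B′} eA eB = begin
    (+ 1 + x) * (+ 1 + y) * ((+ 2 + (x + y)) * (A′ * B′))
      ≡⟨ solve (x ∷ y ∷ A′ ∷ B′ ∷ []) ⟩
    (+ 2 + (x + y)) * ((+ 1 + x) * A′) * ((+ 1 + y) * B′)
      ≡⟨ cong₂ (λ U V → (+ 2 + (x + y)) * U * V) eA eB ⟩
    (+ 2 + (x + y)) * (+ 2 * (+ 2 * x + + 1) * A) * (+ 2 * (+ 2 * y + + 1) * B)
      ≡⟨ solve (x ∷ y ∷ A ∷ B ∷ []) ⟩
    + 2 * (+ 2 * (+ 1 + (x + y)) + + 1)
        * ((+ 1 + y) * B * (+ 2 * (+ 2 * x + + 1) * A) + (+ 1 + x) * A * (+ 2 * (+ 2 * y + + 1) * B))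
      + - (+ 16 * (+ 1 + (x + y))) * ((+ 1 + x) * (+ 1 + y) * (A * B))
      ≡⟨ cong₂ (λ U V → + 2 * (+ 2 * (+ 1 + (x + y)) + + 1) * ((+ 1 + y) * B * U + (+ 1 + x) * A * V)
                          + - (+ 16 * (+ 1 + (x + y))) * ((+ 1 + x) * (+ 1 + y) * (A * B)))
           (sym eA) (sym eB) ⟩
    + 2 * (+ 2 * (+ 1 + (x + y)) + + 1) * ((+ 1 + y) * B * ((+ 1 + x) * A′) + (+ 1 + x) * A * ((+ 1 + y) * B′))
      + - (+ 16 * (+ 1 + (x + y))) * ((+ 1 + x) * (+ 1 + y) * (A * B))
      ≡⟨ solve (x ∷ y ∷ A ∷ A′ ∷ B ∷ B′ ∷ []) ⟩
    (+ 1 + x) * (+ 1 + y) * (+ 2 * (+ 2 * (+ 1 + (x + y)) + + 1) * (A′ * B + A * B′)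
                               + - (+ 16 * (+ 1 + (x + y))) * (A * B)) ∎

centralConvolution-rec : ∀ n k →
  ConvolutionStep n (centralConvolution (suc n) k)
    (centralConvolution n k) (delay (centralConvolution n) k) (delay (centralConvolution (n ℕ.∸ 1)) k)
centralConvolution-rec n zero =
  trans (cong (+ suc n *_) (ℤP.*-identityˡ (centralBinomial (suc n))))
    (convolutionStep-boundary n (centralConvolution n 0) (+ 0)
      (trans (ℤP.+-identityʳ (centralConvolution n 0)) (ℤP.*-identityˡ (centralBinomial n))))
centralConvolution-rec n (suc j) with ℕP.<-cmp j n
... | tri> _ _ n<j = convolutionStep-cong n
  (centralConvolution-beyond (s≤s n<j)) (centralConvolution-beyond (ℕP.m<n⇒m<1+n n<j))
  (centralConvolution-beyond n<j) (centralConvolution-beyond (ℕP.≤-<-trans (ℕP.m∸n≤m n 1) n<j))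
  (vanishing (+ suc n) (+ 2 * (+ 2 * + n + + 1)) (- (+ 16 * + n)))
  where
  vanishing : ∀ s α β → s * + 0 ≡ α * (+ 0 + + 0) + β * + 0
  vanishing = solve-∀
... | tri≈ _ refl _ = diagonal n
  where
  diagonal : ∀ j → ConvolutionStep j (centralConvolution (suc j) (suc j))
    (centralConvolution j (suc j)) (centralConvolution j j) (centralConvolution (j ℕ.∸ 1) j)
  diagonal zero    = refl
  diagonal (suc j) = convolutionStep-cong (suc j)
    (on-diagonal (suc (suc j))) (centralConvolution-beyond (ℕP.n<1+n (suc j)))
    (on-diagonal (suc j)) (centralConvolution-beyond (ℕP.n<1+n j))
    (convolutionStep-boundary (suc j) (+ 0) (centralBinomial (suc j)) (ℤP.+-identityˡ (centralBinomial (suc j))))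
    where
    on-diagonal : ∀ i → centralConvolution i i ≡ centralBinomial i
    on-diagonal i = trans
      (cong (centralBinomial i *_) (trans (mirror-≤ centralBinomial (ℕP.≤-refl {i})) (cong centralBinomial (ℕP.n∸n≡0 i))))
      (ℤP.*-identityʳ (centralBinomial i))
... | tri< j<n _ _ with ℕP.m≤n⇒∃[o]m+o≡n j<n
...   | t , refl = convolutionStep-cong (suc (j ℕ.+ t))
  (cong (centralBinomial (suc j) *_) mirror-suc) (cong (centralBinomial (suc j) *_) (mirror-+ centralBinomial j t))
  (cong (centralBinomial j *_) mirror-suc) (cong (centralBinomial j *_) (mirror-+ centralBinomial j t))
  (convolutionStep-product j t)
  where
  mirror-suc : mirror centralBinomial (suc (j ℕ.+ t)) j ≡ centralBinomial (suc t)
  mirror-suc = trans (cong (λ n → mirror centralBinomial n j) (sym (ℕP.+-suc j t)))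
                     (mirror-+ centralBinomial j (suc t))

centralSum : ℕ → (ℕ → ℤ) → ℤ
centralSum n w = sumTo n (centralConvolution n ⊙ w)

centralSum-cong : ∀ n {v w : ℕ → ℤ} → (∀ k → v k ≡ w k) → centralSum n v ≡ centralSum n w
centralSum-cong n v≗w = sumTo-cong n (λ k → cong (centralConvolution n k *_) (v≗w k))

centralSum-rec : ∀ n w →
  + suc n * centralSum (suc n) w ≡
  + 2 * (+ 2 * + n + + 1) * (centralSum n w + centralSum n (w ∘ suc))
    + - (+ 16 * + n) * centralSum (n ℕ.∸ 1) (w ∘ suc)
centralSum-rec n w = begin
  + suc n * centralSum (suc n) w
    ≡⟨ sumTo-⊙-rec (suc n) (+ suc n) α β (a (suc n)) (a n) (delay (a n)) (delay (a (n ℕ.∸ 1))) w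
         (centralConvolution-rec n) ⟩
  α * (sumTo (suc n) (a n ⊙ w) + sumTo (suc n) (delay (a n) ⊙ w)) + β * sumTo (suc n) (delay (a (n ℕ.∸ 1)) ⊙ w)
    ≡⟨ cong₂ (λ u v → α * u + β * v)
         (cong₂ _+_ (sumTo-suc-vanishing n (a n ⊙ w) (top n w)) (sumTo-delay-⊙ n (a n) w))
         (trans (sumTo-delay-⊙ n (a (n ℕ.∸ 1)) w) (previous n)) ⟩
  α * (centralSum n w + centralSum n (w ∘ suc)) + β * centralSum (n ℕ.∸ 1) (w ∘ suc) ∎
  where
  a = centralConvolution
  α = + 2 * (+ 2 * + n + + 1)
  β = - (+ 16 * + n)
  top : ∀ m v → (a m ⊙ v) (suc m) ≡ + 0
  top m v = cong (_* v (suc m)) (centralConvolution-beyond (ℕP.n<1+n m))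
  previous : ∀ n → sumTo n (a (n ℕ.∸ 1) ⊙ (w ∘ suc)) ≡ centralSum (n ℕ.∸ 1) (w ∘ suc)
  previous zero    = refl
  previous (suc m) = sumTo-suc-vanishing m (a m ⊙ (w ∘ suc)) (top m (w ∘ suc))

-- Sums of squared binomial coefficients

binomialSquare : ℕ → ℕ → ℤ
binomialSquare n k = binomial n k * binomial n k

binomialSquare-beyond : ∀ {n k} → n < k → binomialSquare n k ≡ + 0
binomialSquare-beyond n<k = cong (λ b → b * b) (binomial-beyond n<k)

-- The two sides differ by 2 (ab + bc - x b² + (x + 2) ac), which the ratio relations kill
-- after multiplication by (j + 1)(j + 2).
binomialSquare-interior : ∀ x j {a b c B₂ B₁ B₁′} → B₂ ≡ a + b + (b + c) → B₁ ≡ b + c → B₁′ ≡ a + b →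
  + suc j * b ≡ (x - + j) * a → + suc (suc j) * c ≡ (x - + suc j) * b →
  (+ 2 + x) * (B₂ * B₂) ≡
  (+ 2 * (+ 1 + x) + + 1) * (B₁ * B₁ + B₁′ * B₁′) + - (+ 1 + x) * (c * c - b * b - (b * b - a * a))
binomialSquare-interior x j {a} {b} {c} refl refl refl eb ec =
  ℤP.i-j≡0⇒i≡j _ _ (trans (expand x a b c) (cong (+ 2 *_) defect≡0))
  where
  expand : ∀ x a b c →
    (+ 2 + x) * ((a + b + (b + c)) * (a + b + (b + c)))
      - ((+ 2 * (+ 1 + x) + + 1) * ((b + c) * (b + c) + (a + b) * (a + b))
         + - (+ 1 + x) * (c * c - b * b - (b * b - a * a)))
    ≡ + 2 * (a * b + b * c - x * (b * b) + (x + + 2) * (a * c))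
  expand = solve-∀
  scaled : ∀ y → (+ 1 + y) * b ≡ (x - y) * a → (+ 2 + y) * c ≡ (x - (+ 1 + y)) * b →
    (+ 1 + y) * (+ 2 + y) * (a * b + b * c - x * (b * b) + (x + + 2) * (a * c)) ≡ + 0
  scaled y eb ec = begin
    (+ 1 + y) * (+ 2 + y) * (a * b + b * c - x * (b * b) + (x + + 2) * (a * c))
      ≡⟨ solve (x ∷ y ∷ a ∷ b ∷ c ∷ []) ⟩
    (+ 1 + y) * ((+ 2 + y) * (a * b) - x * (+ 2 + y) * (b * b) + (b + (x + + 2) * a) * ((+ 2 + y) * c))
      ≡⟨ cong (λ C → (+ 1 + y) * ((+ 2 + y) * (a * b) - x * (+ 2 + y) * (b * b) + (b + (x + + 2) * a) * C)) ec ⟩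
    (+ 1 + y) * ((+ 2 + y) * (a * b) - x * (+ 2 + y) * (b * b) + (b + (x + + 2) * a) * ((x - (+ 1 + y)) * b))
      ≡⟨ solve (x ∷ y ∷ a ∷ b ∷ []) ⟩
    ((+ 1 + y) * (+ 2 + y) + (x + + 2) * (x - (+ 1 + y)) * (+ 1 + y)) * (a * b)
      + (x - (+ 1 + y) - x * (+ 2 + y)) * b * ((+ 1 + y) * b)
      ≡⟨ cong (λ B → ((+ 1 + y) * (+ 2 + y) + (x + + 2) * (x - (+ 1 + y)) * (+ 1 + y)) * (a * b)
                       + (x - (+ 1 + y) - x * (+ 2 + y)) * b * B) eb ⟩
    ((+ 1 + y) * (+ 2 + y) + (x + + 2) * (x - (+ 1 + y)) * (+ 1 + y)) * (a * b)
      + (x - (+ 1 + y) - x * (+ 2 + y)) * b * ((x - y) * a)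
      ≡⟨ solve (x ∷ y ∷ a ∷ b ∷ []) ⟩
    + 0 ∎
  defect≡0 : a * b + b * c - x * (b * b) + (x + + 2) * (a * c) ≡ + 0
  defect≡0 = ℤP.*-cancelˡ-≡ (+ suc j * + suc (suc j)) _ (+ 0)
    (trans (scaled (+ j) eb ec) (sym (ℤP.*-zeroʳ (+ suc j * + suc (suc j)))))

binomialSquare-rec : ∀ m k →
  + suc (suc m) * binomialSquare (suc (suc m)) k ≡
  (+ 2 * + suc m + + 1) * (binomialSquare (suc m) k + delay (binomialSquare (suc m)) k)
    + - + suc m * difference (difference (binomialSquare m)) k
binomialSquare-rec m zero = at-zero (+ m)
  where
  at-zero : ∀ x → (+ 2 + x) * + 1 ≡ (+ 2 * (+ 1 + x) + + 1) * (+ 1 + + 0) + - (+ 1 + x) * + 1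
  at-zero = solve-∀
binomialSquare-rec m (suc zero) =
  at-one (+ m) (binomial-1 (suc (suc m))) (binomial-1 (suc m)) (binomial-1 m)
  where
  at-one : ∀ x {B₂ B₁ B₀} → B₂ ≡ + 2 + x → B₁ ≡ + 1 + x → B₀ ≡ x →
    (+ 2 + x) * (B₂ * B₂) ≡ (+ 2 * (+ 1 + x) + + 1) * (B₁ * B₁ + + 1) + - (+ 1 + x) * (B₀ * B₀ - + 1 - + 1)
  at-one x refl refl refl = solve (x ∷ [])
binomialSquare-rec m (suc (suc j)) = binomialSquare-interior (+ m) j
  (trans (binomial-pascal (suc m) (suc j)) (cong₂ _+_ (binomial-pascal m j) (binomial-pascal m (suc j))))
  (binomial-pascal m (suc j)) (binomial-pascal m j) (binomial-ratio m j) (binomial-ratio m (suc j))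

binomialSquareSum : ℕ → ℤ → ℤ
binomialSquareSum n x = sumTo n (binomialSquare n ⊙ (x ^_))

binomialSquareSum-rec : ∀ n x →
  + suc n * binomialSquareSum (suc n) x ≡
  (+ 2 * + n + + 1) * (+ 1 + x) * binomialSquareSum n x
    - + n * ((+ 1 - x) * (+ 1 - x)) * binomialSquareSum (n ℕ.∸ 1) x
binomialSquareSum-rec zero    x = at-zero x
  where
  at-zero : ∀ x → + 1 * (+ 1 + + 1 * (x * + 1)) ≡
    (+ 2 * + 0 + + 1) * (+ 1 + x) * + 1 - + 0 * ((+ 1 - x) * (+ 1 - x)) * + 1
  at-zero = solve-∀
binomialSquareSum-rec (suc m) x = begin
  + suc (suc m) * binomialSquareSum (suc (suc m)) x
    ≡⟨ sumTo-⊙-rec (suc (suc m)) (+ suc (suc m)) α (- + suc m) (t (suc (suc m))) (t (suc m))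
         (delay (t (suc m))) (difference (difference (t m))) (x ^_) (binomialSquare-rec m) ⟩
  α * (sumTo (suc (suc m)) (t (suc m) ⊙ (x ^_)) + sumTo (suc (suc m)) (delay (t (suc m)) ⊙ (x ^_)))
    + - + suc m * sumTo (suc (suc m)) (difference (difference (t m)) ⊙ (x ^_))
    ≡⟨ cong₂ (λ u v → α * u + - + suc m * v)
         (cong₂ _+_ (sumTo-suc-vanishing (suc m) (t (suc m) ⊙ (x ^_)) (cong (_* x ^ suc (suc m)) (top (suc m))))
                    (sumTo-delay-pow (suc m) (t (suc m)) x))
         (trans (sumTo-difference-pow (suc m) (difference (t m)) x
                   (cong₂ _-_ (binomialSquare-beyond (ℕP.m<n⇒m<1+n (ℕP.n<1+n m))) (top m)))
                (cong ((+ 1 - x) *_) (sumTo-difference-pow m (t m) x (top m)))) ⟩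
  α * (binomialSquareSum (suc m) x + x * binomialSquareSum (suc m) x)
    + - + suc m * ((+ 1 - x) * ((+ 1 - x) * binomialSquareSum m x))
    ≡⟨ collect α (+ suc m) x (binomialSquareSum (suc m) x) (binomialSquareSum m x) ⟩
  α * (+ 1 + x) * binomialSquareSum (suc m) x - + suc m * ((+ 1 - x) * (+ 1 - x)) * binomialSquareSum m x ∎
  where
  t = binomialSquare
  α = + 2 * + suc m + + 1
  top : ∀ n → t n (suc n) ≡ + 0
  top n = binomialSquare-beyond (ℕP.n<1+n n)
  collect : ∀ α y x T U → α * (T + x * T) + - y * ((+ 1 - x) * ((+ 1 - x) * U)) ≡
    α * (+ 1 + x) * T - y * ((+ 1 - x) * (+ 1 - x)) * U
  collect = solve-∀

FibonacciLike : (ℤ → ℤ) → Set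
FibonacciLike G = ∀ x → G (x + + 2) ≡ G (x + + 1) + G x

fibonacciLike-+4 : ∀ G → FibonacciLike G → ∀ x → G x + G (x + + 4) ≡ + 3 * G (x + + 2)
fibonacciLike-+4 G rec x = begin
  G x + G (x + + 4)
    ≡⟨ cong (λ y → G x + G y) (ℤP.+-assoc x (+ 2) (+ 2)) ⟨
  G x + G (x + + 2 + + 2)
    ≡⟨ cong (λ y → G x + y) (rec (x + + 2)) ⟩
  G x + (G (x + + 2 + + 1) + G (x + + 2))
    ≡⟨ cong (λ y → G x + (G y + G (x + + 2))) (trans (ℤP.+-assoc x (+ 2) (+ 1)) (sym (ℤP.+-assoc x (+ 1) (+ 2)))) ⟩
  G x + (G (x + + 1 + + 2) + G (x + + 2))
    ≡⟨ cong (λ y → G x + (y + G (x + + 2))) (rec (x + + 1)) ⟩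
  G x + (G (x + + 1 + + 1) + G (x + + 1) + G (x + + 2))
    ≡⟨ cong (λ y → G x + (G y + G (x + + 1) + G (x + + 2))) (ℤP.+-assoc x (+ 1) (+ 1)) ⟩
  G x + (G (x + + 2) + G (x + + 1) + G (x + + 2))
    ≡⟨ regroup (G x) (G (x + + 1)) (G (x + + 2)) ⟩
  + 2 * G (x + + 2) + (G (x + + 1) + G x)
    ≡⟨ cong (λ y → + 2 * G (x + + 2) + y) (rec x) ⟨
  + 2 * G (x + + 2) + G (x + + 2)
    ≡⟨ triple (G (x + + 2)) ⟩
  + 3 * G (x + + 2) ∎
  where
  regroup : ∀ a b c → a + (c + b + c) ≡ + 2 * c + (b + a)
  regroup = solve-∀
  triple : ∀ c → + 2 * c + c ≡ + 3 * c
  triple = solve-∀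

-- On negative indices the recurrence reduces to this identity for the alternating sign s.
alternating : ∀ s a b → s * a ≡ - s * b + - - s * (b + a)
alternating = solve-∀

F-fibonacciLike : FibonacciLike F
F-fibonacciLike (+ n) rewrite ℕP.+-comm n 2 | ℕP.+-comm n 1 = ℤP.pos-+ (fibℕ (suc n)) (fibℕ n)
F-fibonacciLike -[1+ 0 ] = refl
F-fibonacciLike -[1+ 1 ] = refl
F-fibonacciLike -[1+ suc (suc k) ] =
  trans (alternating (sgn k) (+ fibℕ (suc k)) (+ fibℕ (suc (suc k))))
    (cong (λ z → - sgn k * + fibℕ (suc (suc k)) + - - sgn k * z)
      (sym (ℤP.pos-+ (fibℕ (suc (suc k))) (fibℕ (suc k)))))

L-fibonacciLike : FibonacciLike L
L-fibonacciLike (+ n) rewrite ℕP.+-comm n 2 | ℕP.+-comm n 1 = ℤP.pos-+ (lucℕ (suc n)) (lucℕ n)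
L-fibonacciLike -[1+ 0 ] = refl
L-fibonacciLike -[1+ 1 ] = refl
L-fibonacciLike -[1+ suc (suc k) ] =
  trans (alternating (sgn (suc k)) (+ lucℕ (suc k)) (+ lucℕ (suc (suc k))))
    (cong (λ z → - sgn (suc k) * + lucℕ (suc (suc k)) + - - sgn (suc k) * z)
      (sym (ℤP.pos-+ (lucℕ (suc (suc k))) (lucℕ (suc k)))))

-- The common recurrence of both sides

-- At n = 0 the last term has coefficient 0, so the junk value 0 ∸ 1 = 0 is harmless.
Recurrent : (ℕ → ℤ → ℤ) → Set
Recurrent X = ∀ n r →
  + suc n * X (suc n) r ≡
  + 2 * (+ 2 * + n + + 1) * (X n r + X n (r + + 4)) + - (+ 16 * + n) * X (n ℕ.∸ 1) (r + + 4)

recurrent-unique : ∀ X Y → Recurrent X → Recurrent Y → (∀ r → X 0 r ≡ Y 0 r) → ∀ n r → X n r ≡ Y n r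
recurrent-unique X Y recX recY X₀≗Y₀ n = proj₁ (agree n)
  where
  step : ∀ n → (∀ r → X n r ≡ Y n r) → (∀ r → X (n ℕ.∸ 1) r ≡ Y (n ℕ.∸ 1) r) →
    ∀ r → X (suc n) r ≡ Y (suc n) r
  step n Xₙ≗Yₙ Xₙ₋₁≗Yₙ₋₁ r = ℤP.*-cancelˡ-≡ (+ suc n) _ _ (begin
    + suc n * X (suc n) r
      ≡⟨ recX n r ⟩
    + 2 * (+ 2 * + n + + 1) * (X n r + X n (r + + 4)) + - (+ 16 * + n) * X (n ℕ.∸ 1) (r + + 4)
      ≡⟨ cong₂ (λ u v → + 2 * (+ 2 * + n + + 1) * u + - (+ 16 * + n) * v)
           (cong₂ _+_ (Xₙ≗Yₙ r) (Xₙ≗Yₙ (r + + 4))) (Xₙ₋₁≗Yₙ₋₁ (r + + 4)) ⟩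
    + 2 * (+ 2 * + n + + 1) * (Y n r + Y n (r + + 4)) + - (+ 16 * + n) * Y (n ℕ.∸ 1) (r + + 4)
      ≡⟨ recY n r ⟨
    + suc n * Y (suc n) r ∎)
  agree : ∀ n → (∀ r → X n r ≡ Y n r) × (∀ r → X (suc n) r ≡ Y (suc n) r)
  agree zero    = X₀≗Y₀ , step 0 X₀≗Y₀ X₀≗Y₀
  agree (suc n) = let Xₙ≗Yₙ , Xₙ₊₁≗Yₙ₊₁ = agree n in Xₙ₊₁≗Yₙ₊₁ , step (suc n) Xₙ₊₁≗Yₙ₊₁ Xₙ≗Yₙ

convolutionSide : (ℤ → ℤ) → ℕ → ℤ → ℤ
convolutionSide G n r = centralSum n (λ k → G (+ (4 ℕ.* k) + r))

convolutionSide-recurrent : ∀ G → Recurrent (convolutionSide G)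
convolutionSide-recurrent G n r = trans (centralSum-rec n (λ k → G (+ (4 ℕ.* k) + r)))
  (cong₂ (λ u v → + 2 * (+ 2 * + n + + 1) * (convolutionSide G n r + u) + - (+ 16 * + n) * v)
    (centralSum-cong n shift) (centralSum-cong (n ℕ.∸ 1) shift))
  where
  4[1+k]≡4+4k : ∀ k → 4 ℕ.* suc k ≡ 4 ℕ.+ 4 ℕ.* k
  4[1+k]≡4+4k = ℕSolver.solve-∀
  regroup : ∀ a r → + 4 + a + r ≡ a + (r + + 4)
  regroup = solve-∀
  shift : ∀ k → G (+ (4 ℕ.* suc k) + r) ≡ G (+ (4 ℕ.* k) + (r + + 4))
  shift k = cong G (trans (cong (λ m → + m + r) (4[1+k]≡4+4k k)) (regroup (+ (4 ℕ.* k)) r))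

productSide : (ℤ → ℤ) → ℕ → ℤ → ℤ
productSide G n r = G (+ (2 ℕ.* n) + r) * binomialSquareSum n (+ 5)

productSide-recurrent : ∀ G → FibonacciLike G → Recurrent (productSide G)
productSide-recurrent G fib n r = begin
  + suc n * (G₂ * S (suc n))
    ≡⟨ x∙yz≈y∙xz (+ suc n) G₂ (S (suc n)) ⟩
  G₂ * (+ suc n * S (suc n))
    ≡⟨ cong (G₂ *_) (trans (binomialSquareSum-rec n (+ 5)) (at-five (+ n) (S n) (S (n ℕ.∸ 1)))) ⟩
  G₂ * (+ 3 * α * S n + β * S (n ℕ.∸ 1))
    ≡⟨ rearrange α β G₂ (S n) (S (n ℕ.∸ 1)) ⟩
  α * (+ 3 * G₂ * S n) + β * (G₂ * S (n ℕ.∸ 1))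
    ≡⟨ cong₂ _+_ (cong (α *_) (sym current)) (sym (previous n)) ⟩
  α * (productSide G n r + productSide G n (r + + 4)) + β * productSide G (n ℕ.∸ 1) (r + + 4) ∎
  where
  S = λ n → binomialSquareSum n (+ 5)
  α = + 2 * (+ 2 * + n + + 1)
  β = - (+ 16 * + n)
  x = + (2 ℕ.* n) + r
  G₂ = G (+ (2 ℕ.* suc n) + r)
  at-five : ∀ y T U → (+ 2 * y + + 1) * (+ 1 + + 5) * T - y * ((+ 1 - + 5) * (+ 1 - + 5)) * U
                      ≡ + 3 * (+ 2 * (+ 2 * y + + 1)) * T + - (+ 16 * y) * U
  at-five = solve-∀
  rearrange : ∀ α β g T U → g * (+ 3 * α * T + β * U) ≡ α * (+ 3 * g * T) + β * (g * U)
  rearrange = solve-∀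
  x+2≡2[1+n]+r : x + + 2 ≡ + (2 ℕ.* suc n) + r
  x+2≡2[1+n]+r = trans (shuffle (+ (2 ℕ.* n)) r) (cong (λ m → + m + r) (sym (2[1+n]≡2+2n n)))
    where
    2[1+n]≡2+2n : ∀ n → 2 ℕ.* suc n ≡ 2 ℕ.+ 2 ℕ.* n
    2[1+n]≡2+2n = ℕSolver.solve-∀
    shuffle : ∀ a r → a + r + + 2 ≡ + 2 + a + r
    shuffle = solve-∀
  current : productSide G n r + productSide G n (r + + 4) ≡ + 3 * G₂ * S n
  current = begin
    G x * S n + G (+ (2 ℕ.* n) + (r + + 4)) * S n
      ≡⟨ cong (λ y → G x * S n + G y * S n) (sym (ℤP.+-assoc (+ (2 ℕ.* n)) r (+ 4))) ⟩
    G x * S n + G (x + + 4) * S n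
      ≡⟨ ℤP.*-distribʳ-+ (S n) (G x) (G (x + + 4)) ⟨
    (G x + G (x + + 4)) * S n
      ≡⟨ cong (_* S n) (fibonacciLike-+4 G fib x) ⟩
    + 3 * G (x + + 2) * S n
      ≡⟨ cong (λ y → + 3 * G y * S n) x+2≡2[1+n]+r ⟩
    + 3 * G₂ * S n ∎
  previous : ∀ n → - (+ 16 * + n) * productSide G (n ℕ.∸ 1) (r + + 4) ≡
    - (+ 16 * + n) * (G (+ (2 ℕ.* suc n) + r) * S (n ℕ.∸ 1))
  previous zero    = refl
  previous (suc m) = cong (λ y → - (+ 16 * + suc m) * (G y * S m)) (index m)
    where
    2[2+m]≡4+2m : ∀ m → 2 ℕ.* suc (suc m) ≡ 4 ℕ.+ 2 ℕ.* m
    2[2+m]≡4+2m = ℕSolver.solve-∀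
    shuffle : ∀ a r → a + (r + + 4) ≡ + 4 + a + r
    shuffle = solve-∀
    index : ∀ m → + (2 ℕ.* m) + (r + + 4) ≡ + (2 ℕ.* suc (suc m)) + r
    index m = trans (shuffle (+ (2 ℕ.* m)) r) (cong (λ k → + k + r) (sym (2[2+m]≡4+2m m)))

convolutionSide-0≡productSide-0 : ∀ G r → convolutionSide G 0 r ≡ productSide G 0 r
convolutionSide-0≡productSide-0 G r = ℤP.*-comm (+ 1) (G (+ 0 + r))

centralBinomialConvolution-identity : ∀ G → FibonacciLike G → (r : ℤ) (n : ℕ) →
  sumTo n (λ k → + (((2 ℕ.* k) C k) ℕ.* ((2 ℕ.* (n ℕ.∸ k)) C (n ℕ.∸ k))) * G (+ (4 ℕ.* k) + r))
    ≡ G (+ (2 ℕ.* n) + r) * sumTo n (λ k → + ((n C k) ℕ.* (n C k) ℕ.* (5 ℕ.^ k)))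
centralBinomialConvolution-identity G fib r n = begin
  sumTo n (λ k → + (((2 ℕ.* k) C k) ℕ.* ((2 ℕ.* (n ℕ.∸ k)) C (n ℕ.∸ k))) * G (+ (4 ℕ.* k) + r))
    ≡⟨ sumTo-cong-≤ n (λ k k≤n → cong (_* G (+ (4 ℕ.* k) + r)) (coefficient k≤n)) ⟩
  convolutionSide G n r
    ≡⟨ recurrent-unique (convolutionSide G) (productSide G) (convolutionSide-recurrent G)
         (productSide-recurrent G fib) (convolutionSide-0≡productSide-0 G) n r ⟩
  productSide G n r
    ≡⟨ cong (G (+ (2 ℕ.* n) + r) *_) (sumTo-cong n term) ⟨
  G (+ (2 ℕ.* n) + r) * sumTo n (λ k → + ((n C k) ℕ.* (n C k) ℕ.* (5 ℕ.^ k))) ∎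
  where
  coefficient : ∀ {k} → k ≤ n →
    + (((2 ℕ.* k) C k) ℕ.* ((2 ℕ.* (n ℕ.∸ k)) C (n ℕ.∸ k))) ≡ centralConvolution n k
  coefficient {k} k≤n =
    trans (ℤP.pos-* ((2 ℕ.* k) C k) _) (cong (centralBinomial k *_) (sym (mirror-≤ centralBinomial k≤n)))
  term : ∀ k → + ((n C k) ℕ.* (n C k) ℕ.* (5 ℕ.^ k)) ≡ binomialSquare n k * (+ 5) ^ k
  term k = trans (ℤP.pos-* ((n C k) ℕ.* (n C k)) (5 ℕ.^ k)) (cong₂ _*_ (ℤP.pos-* (n C k) (n C k)) (pos-^ 5 k))

theorem21 : (r : ℤ) (n : ℕ) →
    (sumTo n (λ k → + (((2 ℕ.* k) C k) ℕ.* ((2 ℕ.* (n ℕ.∸ k)) C (n ℕ.∸ k))) ℤ.* F (+ (4 ℕ.* k) ℤ.+ r))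
      ≡ F (+ (2 ℕ.* n) ℤ.+ r) ℤ.* sumTo n (λ k → + ((n C k) ℕ.* (n C k) ℕ.* (5 ℕ.^ k))))
    × (sumTo n (λ k → + (((2 ℕ.* k) C k) ℕ.* ((2 ℕ.* (n ℕ.∸ k)) C (n ℕ.∸ k))) ℤ.* L (+ (4 ℕ.* k) ℤ.+ r))
      ≡ L (+ (2 ℕ.* n) ℤ.+ r) ℤ.* sumTo n (λ k → + ((n C k) ℕ.* (n C k) ℕ.* (5 ℕ.^ k))))
theorem21 r n =
  centralBinomialConvolution-identity F F-fibonacciLike r n , centralBinomialConvolution-identity L L-fibonacciLike r n
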